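{- Let $f=(\alpha_1\cdots\alpha_n)$ be an $n$-player rule and let $i>m_f$ be an integer. Let $P$ be a position such that $P\to Q$ for some position $Q$ with $\mathrm{ord}_fQ=i$. Then $P\in\mathcal{L}_2$. In the paper's notation, $\overline{\mathrm{Mov}}\{P\mid \mathrm{ord}_fP=i\}\subset\mathcal{L}_2$.
   Context: Positions are finite tuples $P=(a_1,\dots,a_k)$ of integers with $a_1\geqslant\dots\geqslant a_k\geqslant0$, where tuples differing only by trailing zeros are identified. $(0)$ is the empty position, $\mathcal{L}$ is the set of positions other than $(0)$, and $|P|=\sum a_i$ is the volume of $P$. Define the following subsets of $\mathcal{L}$. - $\mathcal{L}_0=\{(1)\}$. - $\mathcal{L}_1$ consists of the positions $(a_1)$ with $a_1\geqslant2$ and the positions $(1,1,\dots,1)$ with at least two entries. - $\mathcal{L}_2=\mathcal{L}\setminus(\mathcal{L}_0\cup\mathcal{L}_1)$. A chomp move $P\to Q$ from $P=(a_1,\dots,a_k)$ chooses $1\leqslant x\leqslant k$ and an integer $a\geqslant0$, and sets $Q=(b_1,\dots,b_k)$ with $b_j=a_j$ for $j<x$ and $b_j=\min(a_j,a)$ for $j\geqslant x$, where $Q$ must be a different position from $P$. Write $\mathrm{Mov}P=\{Q:P\to Q\}$. For a set $\mathcal{S}$ of positions, $\overline{\mathrm{Mov}}\mathcal{S}=\{P: P\to Q\text{ for some }Q\in\mathcal{S}\}$. An $n$-player rule is a tuple $f=(\alpha_1\cdots\alpha_n)$ of distinct reals. Ordinals $\mathrm{ord}_f$ are defined recursively on volume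 as follows. - $\mathrm{ord}_f(0)=0$. - For a position $Q$, set $s_f(Q)=\alpha_{\mathrm{ord}_fQ+1}$ if $\mathrm{ord}_fQ<n$ and $s_f(Q)=\alpha_1$ if $\mathrm{ord}_fQ=n$. - For $P\in\mathcal{L}$, $\mathrm{ord}_fP$ is the unique $i\in\{1,\dots,n\}$ with $\alpha_i=\max_{Q\in\mathrm{Mov}P}s_f(Q)$. Finally, $m_f=\min\{i\in\mathbb{Z}_{>0}: \alpha_{i+1}<\alpha_i\}$, with the convention $\alpha_{n+1}:=\alpha_1$. -}

module Defs where

open import Level using (Level)
open import Data.Nat using (ℕ; zero; suc; _+_; _∸_; _≤_; _<_; _<?_; _≟_; _⊓_; z≤n; s≤s)
open import Data.Nat.ListAction using (sum)
open import Data.Fin using (Fin; toℕ; fromℕ<) renaming (zero to fzero)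
open import Data.List using (List; []; _∷_; foldr; _++_; take; drop; map; filter; length; replicate; upTo; concatMap; head)
open import Data.List.Relation.Unary.All using (All)
open import Data.List.Relation.Unary.Linked using (Linked)
open import Data.Product using (Σ; ∃; _×_; _,_)
open import Data.Sum using (_⊎_)
open import Relation.Nullary using (¬_; yes; no; ¬?)
open import Data.List.Properties using (≡-dec)
open import Relation.Binary.PropositionalEquality using (_≡_; _≢_)
open import Relation.Binary using (StrictTotalOrder; tri<; tri≈; tri>)
open import Function using (_∘_)

-- A position (a₁,…,a_k), a₁ ≥ … ≥ a_k ≥ 0, modulo trailing
-- zeros, is represented canonically by the list of its POSITIVE entries
-- (a nonincreasing list of positive naturals).  The empty list is (0).

_≥′_ : ℕ → ℕ → Set
m ≥′ n = n ≤ m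

IsPos : List ℕ → Set
IsPos P = Linked _≥′_ P × All (λ a → 1 ≤ a) P

vol : List ℕ → ℕ
vol = sum

-- Chomp moves.  chomp x a P (x is 0-indexed, i.e. x = paper's x - 1):
-- b_j = a_j for j < x, b_j = min(a_j, a) for j ≥ x, then normalised by
-- deleting the zero entries (which are trailing, since b is nonincreasing).

chomp : ℕ → ℕ → List ℕ → List ℕ
chomp x a P = filter (λ b → 0 <? b) (take x P ++ map (a ⊓_) (drop x P))

Move : List ℕ → List ℕ → Set
Move P Q = Σ ℕ λ x → Σ ℕ λ a → x < length P × Q ≡ chomp x a P × Q ≢ P

-- The finite list Mov P used to compute ordinals: values a > vol P give
-- the same result as a = vol P, so a ranges over 0..vol P.
movList : List ℕ → List (List ℕ)
movList P = filter (λ Q → ¬? (≡-dec _≟_ Q P))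
                   (concatMap (λ x → map (λ a → chomp x a P) (upTo (suc (vol P))))
                              (upTo (length P)))

-- An (suc n)-player rule is α : Fin (suc n) → A,
-- injective, into a strict total order A (the paper uses ℝ; only the order
-- of the α's matters).  Index i : Fin (suc n) stands for α_{i+1}.

module Rule {c ℓ₁ ℓ₂ : Level} (O : StrictTotalOrder c ℓ₁ ℓ₂) (n : ℕ)
            (α : Fin (suc n) → StrictTotalOrder.Carrier O) where
  open StrictTotalOrder O using (Carrier; compare) renaming (_<_ to _≺_)

  N : ℕ
  N = suc n

  -- α as a 1-indexed sequence α₁,…,α_N with α_{N+1} := α₁
  α′ : ℕ → Carrier
  α′ i with i ∸ 1 <? N
  ... | yes p = α (fromℕ< p)
  ... | no _  = α fzero

  -- index (0-based) of s_f(Q) given o = ord_f Q: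
  -- α_{o+1} if o < N, α₁ if o = N
  nextIdx : ℕ → Fin N
  nextIdx o with o <? N
  ... | yes p = fromℕ< p
  ... | no _  = fzero

  maxIdx : Fin N → Fin N → Fin N
  maxIdx i j with compare (α i) (α j)
  ... | tri< _ _ _ = j
  ... | tri≈ _ _ _ = i
  ... | tri> _ _ _ = i

  -- the index whose α-value is maximal in a nonempty list of indices
  -- (the value on [] is never used: Mov P ≠ ∅ for P ≠ (0))
  argmax : List (Fin N) → Fin N
  argmax []       = fzero
  argmax (i ∷ is) = foldr maxIdx i is

  -- ord_f with fuel (recursion on volume)
  ordF : ℕ → List ℕ → ℕ
  ordF _       []        = 0
  ordF zero    (_ ∷ _)   = 0
  ordF (suc k) P@(_ ∷ _) = suc (toℕ (argmax (map (nextIdx ∘ ordF k) (movList P))))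

  ord : List ℕ → ℕ
  ord P = ordF (suc (vol P)) P

  IsMf : ℕ → Set ℓ₂
  IsMf m = 1 ≤ m × m ≤ N × α′ (suc m) ≺ α′ m
         × (∀ j → 1 ≤ j → j < m → ¬ (α′ (suc j) ≺ α′ j))

InL0 : List ℕ → Set
InL0 P = P ≡ 1 ∷ []

InL1 : List ℕ → Set
InL1 P = (Σ ℕ λ a → 2 ≤ a × P ≡ a ∷ []) ⊎ (Σ ℕ λ k → 2 ≤ k × P ≡ replicate k 1)

InL2 : List ℕ → Set
InL2 P = P ≢ [] × ¬ InL0 P × ¬ InL1 P

{-# OPTIONS --safe #-}
-- A row (a) and a column (1,…,1) each form a chain on which chomp is a
-- single pile: the moves from the member of volume s lead exactly to the
-- members of volume j < s.  Since α₁ < ⋯ < α_m > α_{m+1} for m = m_f, the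
-- best move from the member of volume b + 1 goes to the member of ordinal
-- min(b, m − 1), and induction on volume gives ord = min(j, m) along the
-- chain.  So every move from a position of 𝓛₀ ∪ 𝓛₁ reaches an ordinal at
-- most m_f, while (0) has no move at all.
module Submission where

open import Defs
open import Level using (Level)
open import Data.Nat using (ℕ; zero; suc; _≤_; _<_; _<?_; _≟_; _⊓_; z≤n; s≤s; s≤s⁻¹)
open import Data.Nat.Properties
open import Data.Fin using (Fin; toℕ)
open import Data.Fin.Properties using (toℕ-fromℕ<)
open import Data.List using (List; []; _∷_; map; foldr; filter; length; replicate; upTo)
open import Data.List.Properties using (≡-dec; length-replicate)
open import Data.List.Membership.Propositional using (_∈_; find; lose)
open import Data.List.Membership.Propositional.Properties
open import Data.List.Relation.Unary.Any using (here; there)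
open import Data.Product using (Σ; _×_; _,_)
open import Data.Sum using (_⊎_; inj₁; inj₂; [_,_]′)
open import Data.Empty using (⊥-elim)
open import Relation.Nullary using (¬_; ¬?; yes; no)
open import Relation.Binary using (StrictTotalOrder; tri<; tri≈; tri>)
import Relation.Binary.Properties.StrictTotalOrder as StrictTotalOrderProperties
open import Function using (_∘_)
open import Function.Definitions using (Injective)
open import Relation.Binary.PropositionalEquality hiding ([_])

¬Move-[] : ∀ {Q} → ¬ Move [] Q
¬Move-[] (_ , _ , () , _)

∈-movList⁻ : ∀ {P Q} → Q ∈ movList P → Move P Q
∈-movList⁻ {P} Q∈ with ∈-filter⁻ (λ Q → ¬? (≡-dec _≟_ Q P)) Q∈
... | Q∈chomps , Q≢P
    with find (∈-concatMap⁻ (λ x → map (λ a → chomp x a P) (upTo (suc (vol P))))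
                            {xs = upTo (length P)} Q∈chomps)
... | x , x∈ , Q∈chompsₓ with ∈-map⁻ (λ a → chomp x a P) {xs = upTo (suc (vol P))} Q∈chompsₓ
... | a , _ , Q≡ = x , a , ∈-upTo⁻ x∈ , Q≡ , Q≢P

∈-movList⁺ : ∀ {P} x a → x < length P → a ≤ vol P → chomp x a P ≢ P → chomp x a P ∈ movList P
∈-movList⁺ {P} x a x<k a≤vol ≢P =
  ∈-filter⁺ (λ Q → ¬? (≡-dec _≟_ Q P))
    (∈-concatMap⁺ (λ x → map (λ a → chomp x a P) (upTo (suc (vol P))))
      (lose (∈-upTo⁺ x<k) (∈-map⁺ (λ a → chomp x a P) (∈-upTo⁺ (s≤s a≤vol)))))
    ≢P

record Chain : Set where
  field
    pos            : ℕ → List ℕ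
    pos-zero       : pos 0 ≡ []
    vol-pos        : ∀ j → vol (pos j) ≡ j
    chomp-pos      : ∀ s x a → Σ ℕ λ j → j ≤ s × chomp x a (pos s) ≡ pos j
    chomp-pos-onto : ∀ {s j} → j < s → Σ ℕ λ x → Σ ℕ λ a →
                     x < length (pos s) × a ≤ vol (pos s) × chomp x a (pos s) ≡ pos j

  pos-injective : ∀ {j s} → pos j ≡ pos s → j ≡ s
  pos-injective {j} {s} eq = trans (sym (vol-pos j)) (trans (cong vol eq) (vol-pos s))

  pos-suc≢[] : ∀ b → pos (suc b) ≢ []
  pos-suc≢[] b eq = 1+n≢0 (trans (sym (vol-pos (suc b))) (cong vol eq))

  Move-pos : ∀ {s Q} → Move (pos s) Q → Σ ℕ λ j → j < s × Q ≡ pos j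
  Move-pos {s} (x , a , _ , Q≡ , Q≢) with chomp-pos s x a
  ... | j , j≤s , chomp≡ with m≤n⇒m<n∨m≡n j≤s
  ...   | inj₁ j<s = j , j<s , trans Q≡ chomp≡
  ...   | inj₂ refl = ⊥-elim (Q≢ (trans Q≡ chomp≡))

  pos∈movList : ∀ {s j} → j < s → pos j ∈ movList (pos s)
  pos∈movList {s} {j} j<s with chomp-pos-onto j<s
  ... | x , a , x<k , a≤vol , chomp≡ =
    subst (_∈ movList (pos s)) chomp≡
      (∈-movList⁺ x a x<k a≤vol (λ eq → <⇒≢ j<s (pos-injective (trans (sym chomp≡) eq))))

row : ℕ → List ℕ
row zero    = []
row (suc b) = suc b ∷ []

positives-singleton : ∀ w → filter (λ b → 0 <? b) (w ∷ []) ≡ row w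
positives-singleton zero    = refl
positives-singleton (suc _) = refl

chomp-row : ∀ s x a → Σ ℕ λ j → j ≤ s × chomp x a (row s) ≡ row j
chomp-row zero    zero          _ = 0 , z≤n , refl
chomp-row zero    (suc _)       _ = 0 , z≤n , refl
chomp-row (suc b) zero          a = a ⊓ suc b , m⊓n≤n a (suc b) , positives-singleton (a ⊓ suc b)
chomp-row (suc b) (suc zero)    _ = suc b , ≤-refl , refl
chomp-row (suc b) (suc (suc _)) _ = suc b , ≤-refl , refl

chomp-row-onto : ∀ {s j} → j < s → Σ ℕ λ x → Σ ℕ λ a →
                 x < length (row s) × a ≤ vol (row s) × chomp x a (row s) ≡ row j
chomp-row-onto {suc b} {j} j<s =
  0 , j , s≤s z≤n , ≤-trans (<⇒≤ j<s) (m≤m+n (suc b) 0) ,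
  trans (positives-singleton (j ⊓ suc b)) (cong row (m≤n⇒m⊓n≡m (<⇒≤ j<s)))

vol-row : ∀ j → vol (row j) ≡ j
vol-row zero    = refl
vol-row (suc j) = +-identityʳ (suc j)

rowChain : Chain
rowChain = record
  { pos = row ; pos-zero = refl ; vol-pos = vol-row
  ; chomp-pos = chomp-row ; chomp-pos-onto = chomp-row-onto }

col : ℕ → List ℕ
col s = replicate s 1

chomp-col-all : ∀ s → chomp 0 0 (col s) ≡ []
chomp-col-all zero    = refl
chomp-col-all (suc s) = chomp-col-all s

chomp-col-none : ∀ a s → chomp 0 (suc a) (col s) ≡ col s
chomp-col-none a zero = refl
chomp-col-none a (suc s) rewrite ⊓-zeroʳ a = cong (1 ∷_) (chomp-col-none a s)

chomp-col-below : ∀ {s x} → x ≤ s → chomp x 0 (col s) ≡ col x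
chomp-col-below {s} z≤n   = chomp-col-all s
chomp-col-below (s≤s x≤s) = cong (1 ∷_) (chomp-col-below x≤s)

chomp-col : ∀ s x a → Σ ℕ λ j → j ≤ s × chomp x a (col s) ≡ col j
chomp-col s       zero    zero    = 0 , z≤n , chomp-col-all s
chomp-col s       zero    (suc a) = s , ≤-refl , chomp-col-none a s
chomp-col zero    (suc _) _       = 0 , z≤n , refl
chomp-col (suc s) (suc x) a with chomp-col s x a
... | j , j≤s , chomp≡ = suc j , s≤s j≤s , cong (1 ∷_) chomp≡

chomp-col-onto : ∀ {s j} → j < s → Σ ℕ λ x → Σ ℕ λ a →
                 x < length (col s) × a ≤ vol (col s) × chomp x a (col s) ≡ col j
chomp-col-onto {s} {j} j<s =
  j , 0 , subst (j <_) (sym (length-replicate s)) j<s , z≤n , chomp-col-below (<⇒≤ j<s)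

vol-col : ∀ j → vol (col j) ≡ j
vol-col zero    = refl
vol-col (suc j) = cong suc (vol-col j)

colChain : Chain
colChain = record
  { pos = col ; pos-zero = refl ; vol-pos = vol-col
  ; chomp-pos = chomp-col ; chomp-pos-onto = chomp-col-onto }

module Ordinals {c ℓ₁ ℓ₂ : Level} (O : StrictTotalOrder c ℓ₁ ℓ₂) (n : ℕ)
                (α : Fin (suc n) → StrictTotalOrder.Carrier O) where
  open Rule O n α
  open StrictTotalOrder O using (Carrier; _≈_; compare; irrefl; asym; module Eq)
    renaming (_<_ to _≺_; trans to ≺-trans)
  open StrictTotalOrderProperties O using ()
    renaming (_≤_ to _≼_; refl to ≼-refl; trans to ≼-trans)

  ≼⇒⊁ : ∀ {x y} → x ≼ y → ¬ (y ≺ x)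
  ≼⇒⊁ (inj₁ x≺y) = asym x≺y
  ≼⇒⊁ (inj₂ x≈y) = irrefl (Eq.sym x≈y)

  maxIdx-sel : ∀ i j → maxIdx i j ≡ i ⊎ maxIdx i j ≡ j
  maxIdx-sel i j with compare (α i) (α j)
  ... | tri< _ _ _ = inj₂ refl
  ... | tri≈ _ _ _ = inj₁ refl
  ... | tri> _ _ _ = inj₁ refl

  maxIdx-upperˡ : ∀ i j → α i ≼ α (maxIdx i j)
  maxIdx-upperˡ i j with compare (α i) (α j)
  ... | tri< i≺j _ _ = inj₁ i≺j
  ... | tri≈ _ _ _   = ≼-refl
  ... | tri> _ _ _   = ≼-refl

  maxIdx-upperʳ : ∀ i j → α j ≼ α (maxIdx i j)
  maxIdx-upperʳ i j with compare (α i) (α j)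
  ... | tri< _ _ _   = ≼-refl
  ... | tri≈ _ i≈j _ = inj₂ (Eq.sym i≈j)
  ... | tri> _ _ j≺i = inj₁ j≺i

  foldr-maxIdx-∈ : ∀ i is → foldr maxIdx i is ≡ i ⊎ foldr maxIdx i is ∈ is
  foldr-maxIdx-∈ i [] = inj₁ refl
  foldr-maxIdx-∈ i (k ∷ is) with maxIdx-sel k (foldr maxIdx i is)
  ... | inj₁ ≡k = inj₂ (here ≡k)
  ... | inj₂ ≡r with foldr-maxIdx-∈ i is
  ...   | inj₁ r≡i  = inj₁ (trans ≡r r≡i)
  ...   | inj₂ r∈is = inj₂ (there (subst (_∈ is) (sym ≡r) r∈is))

  foldr-maxIdx-upper : ∀ i is {j} → j ∈ i ∷ is → α j ≼ α (foldr maxIdx i is)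
  foldr-maxIdx-upper i []       (here refl)         = ≼-refl
  foldr-maxIdx-upper i (k ∷ is) (there (here refl)) = maxIdx-upperˡ k _
  foldr-maxIdx-upper i (k ∷ is) (here refl)         =
    ≼-trans (foldr-maxIdx-upper i is (here refl)) (maxIdx-upperʳ k _)
  foldr-maxIdx-upper i (k ∷ is) (there (there j∈))  =
    ≼-trans (foldr-maxIdx-upper i is (there j∈)) (maxIdx-upperʳ k _)

  argmax-∈ : ∀ {j l} → j ∈ l → argmax l ∈ l
  argmax-∈ {l = i ∷ is} _ = [ here , there ]′ (foldr-maxIdx-∈ i is)

  argmax-upper : ∀ {j l} → j ∈ l → α j ≼ α (argmax l)
  argmax-upper {l = i ∷ is} = foldr-maxIdx-upper i is

  ordF-suc : ∀ k {P} → P ≢ [] →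
             ordF (suc k) P ≡ suc (toℕ (argmax (map (nextIdx ∘ ordF k) (movList P))))
  ordF-suc k {[]}    P≢[] = ⊥-elim (P≢[] refl)
  ordF-suc k {_ ∷ _} _    = refl

  s : ℕ → Carrier
  s o = α (nextIdx o)

  α′-suc : ∀ o → α′ (suc o) ≡ s o
  α′-suc o with o <? N
  ... | yes _ = refl
  ... | no _  = refl

  toℕ-nextIdx : ∀ {o} → o < N → toℕ (nextIdx o) ≡ o
  toℕ-nextIdx {o} o<N with o <? N
  ... | yes o<N′ = toℕ-fromℕ< o<N′
  ... | no o≮N   = ⊥-elim (o≮N o<N)

  module Peak (α-injective : Injective _≡_ _≈_ α) (m′ : ℕ) (isMf : IsMf (suc m′)) where
    m≤N : suc m′ ≤ N
    m≤N = let _ , m≤N , _ = isMf in m≤N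

    s-drop : s (suc m′) ≺ s m′
    s-drop = let _ , _ , drop , _ = isMf in subst₂ _≺_ (α′-suc (suc m′)) (α′-suc m′) drop

    s-step : ∀ {o} → o < m′ → s o ≺ s (suc o)
    s-step {o} o<m′ with compare (s o) (s (suc o))
    ... | tri< so≺ _ _ = so≺
    ... | tri> _ _ so≻ = let _ , _ , _ , noDrop = isMf in ⊥-elim (noDrop (suc o) (s≤s z≤n) (s≤s o<m′)
                                (subst₂ _≺_ (sym (α′-suc (suc o))) (sym (α′-suc o)) so≻))
    ... | tri≈ _ so≈ _ = ⊥-elim (1+n≢n (begin
      suc o                 ≡⟨ toℕ-nextIdx so<N ⟨
      toℕ (nextIdx (suc o)) ≡⟨ cong toℕ (α-injective so≈) ⟨
      toℕ (nextIdx o)       ≡⟨ toℕ-nextIdx (<-trans (n<1+n o) so<N) ⟩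
      o                     ∎))
      where
      open ≡-Reasoning
      so<N : suc o < N
      so<N = <-≤-trans (s≤s o<m′) m≤N

    s-strictMono : ∀ {a d} → a < d → d ≤ m′ → s a ≺ s d
    s-strictMono {a} {suc d} (s≤s a≤d) d<m′ with m≤n⇒m<n∨m≡n a≤d
    ... | inj₁ a<d  = ≺-trans (s-strictMono a<d (<⇒≤ d<m′)) (s-step d<m′)
    ... | inj₂ refl = s-step d<m′

    -- s increases up to m′ = m_f - 1 and then drops, so among the ordinals
    -- o ≤ min(b, m_f) the value s o is largest exactly at o = min(b, m_f - 1).
    s-peak : ∀ {b o} → o ≤ b → o ≤ suc m′ → s (b ⊓ m′) ≼ s o → o ≡ b ⊓ m′
    s-peak {b} {o} o≤b o≤m peak≼ with <-cmp o (b ⊓ m′)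
    ... | tri< o<t _ _ = ⊥-elim (≼⇒⊁ peak≼ (s-strictMono o<t (m⊓n≤n b m′)))
    ... | tri≈ _ o≡t _ = o≡t
    ... | tri> _ _ t<o with ⊓-sel b m′
    ...   | inj₁ t≡b  = ⊥-elim (<⇒≱ t<o (subst (o ≤_) (sym t≡b) o≤b))
    ...   | inj₂ t≡m′ = ⊥-elim (≼⇒⊁ peak≼ (subst₂ (λ x y → s x ≺ s y) (sym o≡m) (sym t≡m′) s-drop))
      where
      o≡m : o ≡ suc m′
      o≡m = ≤-antisym o≤m (subst (_< o) t≡m′ t<o)

    argmax-peak : ∀ {b L} → nextIdx (b ⊓ m′) ∈ L →
                  (∀ {r} → r ∈ L → Σ ℕ λ o → o ≤ b × o ≤ suc m′ × r ≡ nextIdx o) →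
                  toℕ (argmax L) ≡ b ⊓ m′
    argmax-peak {b} {L} peak∈L values with values (argmax-∈ peak∈L)
    ... | o , o≤b , o≤m , argmax≡ = begin
      toℕ (argmax L)         ≡⟨ cong toℕ argmax≡ ⟩
      toℕ (nextIdx o)        ≡⟨ cong (toℕ ∘ nextIdx) o≡t ⟩
      toℕ (nextIdx (b ⊓ m′)) ≡⟨ toℕ-nextIdx (<-≤-trans (s≤s (m⊓n≤n b m′)) m≤N) ⟩
      b ⊓ m′                 ∎
      where
      open ≡-Reasoning
      o≡t : o ≡ b ⊓ m′
      o≡t = s-peak o≤b o≤m (subst (λ r → s (b ⊓ m′) ≼ α r) argmax≡ (argmax-upper peak∈L))

    module _ (ch : Chain) where
      open Chain ch

      ordF-pos : ∀ {k b} → b < k → ordF k (pos b) ≡ b ⊓ suc m′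
      ordF-pos {suc k} {zero}  _         rewrite pos-zero = refl
      ordF-pos {suc k} {suc b} (s≤s b<k) =
        trans (ordF-suc k (pos-suc≢[] b)) (cong suc (argmax-peak peak∈L values))
        where
        L : List (Fin N)
        L = map (nextIdx ∘ ordF k) (movList (pos (suc b)))

        ordF-below : ∀ {j} → j < suc b → ordF k (pos j) ≡ j ⊓ suc m′
        ordF-below (s≤s j≤b) = ordF-pos (≤-<-trans j≤b b<k)

        t≤b : b ⊓ m′ ≤ b
        t≤b = m⊓n≤m b m′

        peak∈L : nextIdx (b ⊓ m′) ∈ L
        peak∈L = subst (λ o → nextIdx o ∈ L)
          (trans (ordF-below (s≤s t≤b)) (m≤n⇒m⊓n≡m (m≤n⇒m≤1+n (m⊓n≤n b m′))))
          (∈-map⁺ (nextIdx ∘ ordF k) (pos∈movList (s≤s t≤b)))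

        values : ∀ {r} → r ∈ L → Σ ℕ λ o → o ≤ b × o ≤ suc m′ × r ≡ nextIdx o
        values r∈L with ∈-map⁻ (nextIdx ∘ ordF k) r∈L
        ... | Q , Q∈ , r≡ with Move-pos (∈-movList⁻ Q∈)
        ...   | j , j<sb , Q≡ =
          j ⊓ suc m′ , ≤-trans (m⊓n≤m j (suc m′)) (s≤s⁻¹ j<sb) , m⊓n≤n j (suc m′) ,
          trans r≡ (cong nextIdx (trans (cong (ordF k) Q≡) (ordF-below j<sb)))

      ord-pos : ∀ j → ord (pos j) ≡ j ⊓ suc m′
      ord-pos j = subst (λ v → ordF (suc v) (pos j) ≡ j ⊓ suc m′) (sym (vol-pos j)) (ordF-pos (n<1+n j))

      ord-Move-pos≤ : ∀ {s Q} → Move (pos s) Q → ord Q ≤ suc m′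
      ord-Move-pos≤ mv with Move-pos mv
      ... | j , _ , refl = subst (_≤ suc m′) (sym (ord-pos j)) (m⊓n≤n j (suc m′))

corollary3p10 : {c ℓ₁ ℓ₂ : Level} (O : StrictTotalOrder c ℓ₁ ℓ₂) (n : ℕ)
    (α : Fin (suc n) → StrictTotalOrder.Carrier O)
    → Injective _≡_ (StrictTotalOrder._≈_ O) α
    → (m i : ℕ) → Rule.IsMf O n α m → m < i
    → (P Q : List ℕ) → IsPos P → IsPos Q → Move P Q → Rule.ord O n α Q ≡ i
    → InL2 P
corollary3p10 O n α inj zero     i (() , _) _ _ _ _ _ _ _
corollary3p10 O n α inj (suc m′) i isMf m<i P Q _ _ mv ordQ≡i = P≢[] , P∉L0 , P∉L1
  where
  open Rule O n α using (ord)
  open Ordinals O n α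
  open Peak inj m′ isMf

  ord-Q-large : ¬ ord Q ≤ suc m′
  ord-Q-large ordQ≤m = <⇒≱ m<i (subst (_≤ suc m′) ordQ≡i ordQ≤m)

  P≢[] : P ≢ []
  P≢[] refl = ¬Move-[] mv

  P∉L0 : ¬ InL0 P
  P∉L0 refl = ord-Q-large (ord-Move-pos≤ rowChain {1} mv)

  P∉L1 : ¬ InL1 P
  P∉L1 (inj₁ (suc b , _ , refl)) = ord-Q-large (ord-Move-pos≤ rowChain {suc b} mv)
  P∉L1 (inj₂ (k , _ , refl))     = ord-Q-large (ord-Move-pos≤ colChain {k} mv)
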